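{- For every partition $\lambda$ and positive integer $k$, there is a bijection between $\mathrm{BSSYT}(\lambda,k)$ and the set of triples $(P,i,C)$ with $P\in\mathrm{RPP}(\lambda,k)$, $1\le i\le k$, and $C$ a corner of the induced subshape $\alpha(P,i)$. That is, each barely set-valued tableau in $\mathrm{BSSYT}(\lambda,k)$ is uniquely represented by such a triple.
   Context: A partition $\lambda$ is identified with its Young diagram (square $(s,t)$ in row $s$, column $t$, rows numbered from the top). A set-valued semistandard Young tableau of shape $\lambda$ assigns a nonempty finite set of positive integers to each square such that for horizontally adjacent sets $A$ (left), $B$ (right), $\max A\le\min B$, and for vertically adjacent $A$ (above), $B$ (below), $\max A<\min B$; it is barely set-valued if exactly one square has a set of size two and all others have size one. $\mathrm{BSSYT}(\lambda,k)$ is the set of barely set-valued semistandard Young tableaux of shape $\lambda$ with every integer in row $s$ at most $k+s$. $\mathrm{RPP}(\lambda,k)$ is the set of reverse plane partitions of shape $\lambda$ with entries in $\{0,1,\dots,k\}$ (weakly increasing along rows and down columns). For $P\in\mathrm{RPP}(\lambda,k)$ and $1\le i\le k$, $\alpha(P,i)$ is the subshape (Young diagram contained in $\lambda$) consisting of the squares of $P$ with entries strictly less than $i$. A corner of a Young diagram $\mu$ is a square $(s,t)\in\mu$ with $(s+1,t)\notin\mu$ and $(s,t+1)\notin\mu$. -}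

module Defs where

open import Data.Nat using (ℕ; zero; suc; _+_; _≤_; _<_; _≥_)
open import Data.List using (List; []; _∷_; length; map)
open import Data.List.Relation.Unary.All using (All)
open import Data.List.Relation.Unary.AllPairs using (AllPairs)
open import Data.List.Relation.Unary.Linked using (Linked)
open import Data.Maybe using (Maybe; just; nothing)
open import Data.Product using (Σ; _×_; _,_; ∃)
open import Data.Refinement using (Refinement)
open import Relation.Binary.PropositionalEquality using (_≡_; _≢_)
open import Relation.Nullary using (¬_)

IsPartition : List ℕ → Set
IsPartition λ′ = All (λ x → 1 ≤ x) λ′ × Linked _≥_ λ′

-- 1-indexed lookup (index 0 is out of range).
at : {A : Set} → List A → ℕ → Maybe A
at []       _             = nothing
at (x ∷ xs) zero          = nothing
at (x ∷ xs) (suc zero)    = just x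
at (x ∷ xs) (suc (suc n)) = at xs (suc n)

-- A filling of a Young diagram: list of rows (top row first), each a list of entries.
-- Entry in square (s , t): row s, column t, both 1-indexed.
entry : {A : Set} → List (List A) → ℕ → ℕ → Maybe A
entry T s t with at T s
... | just row = at row t
... | nothing  = nothing

HasShape : {A : Set} → List ℕ → List (List A) → Set
HasShape λ′ T = map length T ≡ λ′

-- Set-valued tableaux.  A finite nonempty set of positive integers is
-- represented canonically as a nonempty strictly increasing list.

IsFinSet : List ℕ → Set
IsFinSet A = (A ≢ []) × AllPairs _<_ A

-- max A ≤ min B  (for nonempty A, B)  written as: every a ∈ A, b ∈ B has a ≤ b
MaxLeMin : List ℕ → List ℕ → Set
MaxLeMin A B = All (λ a → All (λ b → a ≤ b) B) A

MaxLtMin : List ℕ → List ℕ → Set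
MaxLtMin A B = All (λ a → All (λ b → a < b) B) A

record IsBSSYT (λ′ : List ℕ) (k : ℕ) (T : List (List (List ℕ))) : Set where
  field
    shape     : HasShape λ′ T
    sets      : ∀ s t A → entry T s t ≡ just A → IsFinSet A
    positive  : ∀ s t A → entry T s t ≡ just A → All (λ x → 1 ≤ x) A
    rowWeak   : ∀ s t A B → entry T s t ≡ just A → entry T s (suc t) ≡ just B → MaxLeMin A B
    colStrict : ∀ s t A B → entry T s t ≡ just A → entry T (suc s) t ≡ just B → MaxLtMin A B
    flagged   : ∀ s t A → entry T s t ≡ just A → All (λ x → x ≤ k + s) A
    barely    : Σ ℕ λ s₀ → Σ ℕ λ t₀ → Σ (List ℕ) λ A₀ →
                  (entry T s₀ t₀ ≡ just A₀) × (length A₀ ≡ 2) ×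
                  (∀ s t A → entry T s t ≡ just A → ¬ ((s , t) ≡ (s₀ , t₀)) → length A ≡ 1)

-- BSSYT(λ,k); the proof component is irrelevant, so elements are equal iff
-- the underlying fillings are equal.
BSSYT : List ℕ → ℕ → Set
BSSYT λ′ k = Refinement (List (List (List ℕ))) (IsBSSYT λ′ k)

record IsRPP (λ′ : List ℕ) (k : ℕ) (P : List (List ℕ)) : Set where
  field
    shape   : HasShape λ′ P
    bounded : ∀ s t x → entry P s t ≡ just x → x ≤ k
    rowWeak : ∀ s t x y → entry P s t ≡ just x → entry P s (suc t) ≡ just y → x ≤ y
    colWeak : ∀ s t x y → entry P s t ≡ just x → entry P (suc s) t ≡ just y → x ≤ y

InAlpha : List (List ℕ) → ℕ → ℕ → ℕ → Set
InAlpha P i s t = Σ ℕ λ x → (entry P s t ≡ just x) × (x < i)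

IsCornerAlpha : List (List ℕ) → ℕ → ℕ × ℕ → Set
IsCornerAlpha P i (s , t) =
  InAlpha P i s t × ¬ InAlpha P i (suc s) t × ¬ InAlpha P i s (suc t)

IsTriple : List ℕ → ℕ → List (List ℕ) × ℕ × (ℕ × ℕ) → Set
IsTriple λ′ k (P , i , C) = IsRPP λ′ k P × (1 ≤ i) × (i ≤ k) × IsCornerAlpha P i C

Triples : List ℕ → ℕ → Set
Triples λ′ k = Refinement (List (List ℕ) × ℕ × (ℕ × ℕ)) (IsTriple λ′ k)

-- Subtracting the row index s from the least element of each set in row s turns
-- a barely set-valued tableau into a reverse plane partition P with entries in
-- {0,…,k}: column strictness becomes weak monotonicity and the flag k + s becomes
-- k.  The one doubled square (s₀ , t₀), holding {a < b}, is remembered by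
-- i = b − s₀: its own entry a − s₀ is below i, while its right and lower
-- neighbours have least elements ≥ b, so it is a corner of α(P,i).  Conversely,
-- writing x + s in each square and adding i + s at the corner C inverts this.
module Submission where

open import Defs
open import Data.Nat using (ℕ; zero; suc; _+_; _∸_; _≤_; _<_; _≥_; z≤n; s≤s)
open import Data.Nat.Properties
open import Data.List using (List; []; _∷_; length; map)
import Data.List.Properties as List
open import Data.List.Relation.Unary.All as All using (All; []; _∷_)
open import Data.List.Relation.Unary.AllPairs using ([]; _∷_)
open import Data.List.Relation.Unary.Linked using (Linked; [-]; _∷_)
open import Data.Maybe as Maybe using (Maybe; just; nothing)
open import Data.Maybe.Properties using (just-injective)
open import Data.Product using (∃; _×_; _,_; proj₁; proj₂)
import Data.Product.Properties as Product
open import Data.Refinement as Ref using (Refinement; value-injective)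
open import Data.Irrelevant using ([_])
open import Data.Empty using (⊥-elim)
open import Relation.Binary.PropositionalEquality
open import Relation.Binary.Definitions using (DecidableEquality)
open import Relation.Nullary using (¬_; yes; no)
open import Relation.Nullary.Decidable.Core using (recompute)
open import Function.Bundles using (_⤖_; mk↔ₛ′)
open import Function.Properties.Inverse using (↔⇒⤖)

private variable
  A B : Set
  x y a b : A

m≤n+o⇒m∸o≤n : ∀ m n o → m ≤ n + o → m ∸ o ≤ n
m≤n+o⇒m∸o≤n m n o le = m≤n+o⇒m∸n≤o m o (≤-trans le (≤-reflexive (+-comm n o)))

refinement-⤖ : {P : A → Set} {Q : B → Set} → DecidableEquality A → DecidableEquality B →
  (f : A → B) (g : B → A) → (∀ {a} → P a → Q (f a)) → (∀ {b} → Q b → P (g b)) →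
  (∀ {b} → Q b → f (g b) ≡ b) → (∀ {a} → P a → g (f a) ≡ a) →
  Refinement A P ⤖ Refinement B Q
refinement-⤖ _≟ᴬ_ _≟ᴮ_ f g f-ok g-ok f∘g g∘f =
  ↔⇒⤖ (mk↔ₛ′ (Ref.map f f-ok) (Ref.map g g-ok) f∘g′ g∘f′)
  where
    -- The inverse laws hold only on the (irrelevant) subsets; decidability of
    -- equality lets us recompute them relevantly.
    f∘g′ : ∀ v → Ref.map f f-ok (Ref.map g g-ok v) ≡ v
    f∘g′ (b Ref., [ q ]) = value-injective (recompute (f (g b) ≟ᴮ b) (f∘g q))
    g∘f′ : ∀ v → Ref.map g g-ok (Ref.map f f-ok v) ≡ v
    g∘f′ (a Ref., [ p ]) = value-injective (recompute (g (f a) ≟ᴬ a) (g∘f p))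

at-0 : (xs : List A) → at xs 0 ≡ nothing
at-0 []      = refl
at-0 (_ ∷ _) = refl

at-∷ : (xs : List A) (t : ℕ) → at xs t ≡ just y → at (x ∷ xs) (suc t) ≡ just y
at-∷ []      zero    ()
at-∷ (_ ∷ _) zero    ()
at-∷ xs      (suc t) e = e

at-bounds : (xs : List A) (t : ℕ) → at xs t ≡ just x → 1 ≤ t × t ≤ length xs
at-bounds (_ ∷ _)  (suc zero)    _ = s≤s z≤n , s≤s z≤n
at-bounds (_ ∷ xs) (suc (suc t)) e = s≤s z≤n , s≤s (proj₂ (at-bounds xs (suc t) e))

at-inBounds : (xs : List A) (t : ℕ) → 1 ≤ t → t ≤ length xs → ∃ λ x → at xs t ≡ just x
at-inBounds (x ∷ _)  (suc zero)    _ _         = x , refl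
at-inBounds (_ ∷ xs) (suc (suc t)) _ (s≤s t≤) = at-inBounds xs (suc t) (s≤s z≤n) t≤

at-map : (f : A → B) (xs : List A) (t : ℕ) → at (map f xs) t ≡ Maybe.map f (at xs t)
at-map f []       t             = refl
at-map f (_ ∷ _)  zero          = refl
at-map f (_ ∷ _)  (suc zero)    = refl
at-map f (_ ∷ xs) (suc (suc t)) = at-map f xs (suc t)

entry⇒at : (T : List (List A)) (s t : ℕ) → entry T s t ≡ just a →
  ∃ λ row → at T s ≡ just row × at row t ≡ just a
entry⇒at T s t e with at T s
... | just row = row , refl , e

at⇒entry : (T : List (List A)) (s t : ℕ) {row : List A} →
  at T s ≡ just row → at row t ≡ just a → entry T s t ≡ just a
at⇒entry T s t eT e rewrite eT = e

entry⇒1≤row : (T : List (List A)) (s t : ℕ) → entry T s t ≡ just a → 1 ≤ s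
entry⇒1≤row T s t e with entry⇒at T s t e
... | row , eT , _ = proj₁ (at-bounds T s eT)

entry-row-0 : (T : List (List A)) (t : ℕ) → entry T 0 t ≡ nothing
entry-row-0 T t rewrite at-0 T = refl

mapRow : (ℕ → A → B) → List A → List B
mapRow f []       = []
mapRow f (x ∷ xs) = f 1 x ∷ mapRow (λ n → f (suc n)) xs

mapGrid : (ℕ → ℕ → A → B) → List (List A) → List (List B)
mapGrid f = mapRow (λ s → mapRow (f s))

at-mapRow : (f : ℕ → A → B) (xs : List A) (t : ℕ) → at (mapRow f xs) t ≡ Maybe.map (f t) (at xs t)
at-mapRow f []       t             = refl
at-mapRow f (_ ∷ _)  zero          = refl
at-mapRow f (_ ∷ _)  (suc zero)    = refl
at-mapRow f (_ ∷ xs) (suc (suc t)) = at-mapRow (λ n → f (suc n)) xs (suc t)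

entry-mapGrid : (f : ℕ → ℕ → A → B) (T : List (List A)) (s t : ℕ) →
  entry (mapGrid f T) s t ≡ Maybe.map (f s t) (entry T s t)
entry-mapGrid f T s t rewrite at-mapRow (λ s → mapRow (f s)) T s with at T s
... | nothing  = refl
... | just row = at-mapRow (f s) row t

entry-mapGrid⁻ : (f : ℕ → ℕ → A → B) (T : List (List A)) (s t : ℕ) →
  entry (mapGrid f T) s t ≡ just b → ∃ λ a → entry T s t ≡ just a × f s t a ≡ b
entry-mapGrid⁻ f T s t e with entry T s t | entry-mapGrid f T s t
... | just a  | eq = a , refl , just-injective (trans (sym eq) e)
... | nothing | eq with () ← trans (sym eq) e

length-mapRow : (f : ℕ → A → B) (xs : List A) → length (mapRow f xs) ≡ length xs
length-mapRow f []       = refl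
length-mapRow f (_ ∷ xs) = cong suc (length-mapRow (λ n → f (suc n)) xs)

shape-mapGrid : (f : ℕ → ℕ → A → B) (T : List (List A)) → map length (mapGrid f T) ≡ map length T
shape-mapGrid f []        = refl
shape-mapGrid f (row ∷ T) =
  cong₂ _∷_ (length-mapRow (f 1) row) (shape-mapGrid (λ n → f (suc n)) T)

mapRow-cancel : (g : ℕ → B → A) (f : ℕ → A → B) (xs : List A) →
  (∀ t x → at xs t ≡ just x → g t (f t x) ≡ x) → mapRow g (mapRow f xs) ≡ xs
mapRow-cancel g f []       _      = refl
mapRow-cancel g f (x ∷ xs) cancel =
  cong₂ _∷_ (cancel 1 x refl)
            (mapRow-cancel (λ n → g (suc n)) (λ n → f (suc n)) xs
               (λ t y e → cancel (suc t) y (at-∷ xs t e)))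

mapGrid-cancel : (g : ℕ → ℕ → B → A) (f : ℕ → ℕ → A → B) (T : List (List A)) →
  (∀ s t a → entry T s t ≡ just a → g s t (f s t a) ≡ a) → mapGrid g (mapGrid f T) ≡ T
mapGrid-cancel g f T cancel =
  mapRow-cancel (λ s → mapRow (g s)) (λ s → mapRow (f s)) T
    (λ s row eT → mapRow-cancel (g s) (f s) row (λ t a e → cancel s t a (at⇒entry T s t eT e)))

firstJust : (A → Maybe B) → List A → Maybe (ℕ × B)
firstJust p []       = nothing
firstJust p (x ∷ xs) with p x
... | just b  = just (1 , b)
... | nothing = Maybe.map (λ (n , b) → suc n , b) (firstJust p xs)

firstJust-nothing : (p : A → Maybe B) (xs : List A) →
  (∀ t x → at xs t ≡ just x → p x ≡ nothing) → firstJust p xs ≡ nothing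
firstJust-nothing p []       _    = refl
firstJust-nothing p (x ∷ xs) none
  rewrite none 1 x refl | firstJust-nothing p xs (λ t y e → none (suc t) y (at-∷ xs t e)) = refl

firstJust-unique : (p : A → Maybe B) (xs : List A) (t₀ : ℕ) {x₀ : A} →
  at xs t₀ ≡ just x₀ → p x₀ ≡ just b →
  (∀ t x → at xs t ≡ just x → t ≢ t₀ → p x ≡ nothing) → firstJust p xs ≡ just (t₀ , b)
firstJust-unique p (x ∷ xs) (suc zero) refl px _ rewrite px = refl
firstJust-unique p (x ∷ xs) (suc (suc t₀)) e px others
  rewrite others 1 x refl (λ ())
        | firstJust-unique p xs (suc t₀) e px
            (λ t y e′ t≢ → others (suc t) y (at-∷ xs t e′) (λ q → t≢ (suc-injective q))) = refl

secondElement : List ℕ → Maybe ℕ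
secondElement (_ ∷ b ∷ _) = just b
secondElement _           = nothing

secondElement-singleton : (A : List ℕ) → length A ≡ 1 → secondElement A ≡ nothing
secondElement-singleton (_ ∷ []) _ = refl

Tableau : Set
Tableau = List (List (List ℕ))

-- Found by search: a map out of BSSYT cannot read the location of the doubled
-- square off the irrelevant barely-set-valued witness.
doubledSquare : Tableau → Maybe (ℕ × ℕ × ℕ)
doubledSquare = firstJust (firstJust secondElement)

doubledSquare-unique : (T : Tableau) (s₀ t₀ : ℕ) {a b : ℕ} →
  entry T s₀ t₀ ≡ just (a ∷ b ∷ []) →
  (∀ s t A → entry T s t ≡ just A → (s , t) ≢ (s₀ , t₀) → length A ≡ 1) →
  doubledSquare T ≡ just (s₀ , t₀ , b)
doubledSquare-unique T s₀ t₀ e₀ single with entry⇒at T s₀ t₀ e₀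
... | row₀ , eT₀ , e = firstJust-unique (firstJust secondElement) T s₀ eT₀
  (firstJust-unique secondElement row₀ t₀ e refl
    (λ t A e′ t≢ → secondElement-singleton A (single s₀ t A (at⇒entry T s₀ t eT₀ e′) (λ q → t≢ (cong proj₂ q)))))
  (λ s row eT s≢ → firstJust-nothing secondElement row
    (λ t A e′ → secondElement-singleton A (single s t A (at⇒entry T s t eT e′) (λ q → s≢ (cong proj₁ q)))))

Triple : Set
Triple = List (List ℕ) × ℕ × (ℕ × ℕ)

-- Sets are strictly increasing lists, so the head is the minimum (0 on [] is junk).
least : List ℕ → ℕ
least []      = 0
least (a ∷ _) = a

least-All : {Q : ℕ → Set} (A : List ℕ) → A ≢ [] → All Q A → Q (least A)
least-All []      A≢[] _       = ⊥-elim (A≢[] refl)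
least-All (_ ∷ _) _    (q ∷ _) = q

least-All² : {R : ℕ → ℕ → Set} (A B : List ℕ) → A ≢ [] → B ≢ [] →
  All (λ a → All (R a) B) A → R (least A) (least B)
least-All² A B A≢[] B≢[] rel = least-All B B≢[] (least-All A A≢[] rel)

toRPP : Tableau → List (List ℕ)
toRPP = mapGrid (λ s _ A → least A ∸ s)

toTriple : Tableau → Triple
toTriple T with doubledSquare T
... | just (s , t , b) = toRPP T , b ∸ s , (s , t)
... | nothing          = toRPP T , 0 , (0 , 0)

_≟²_ : DecidableEquality (ℕ × ℕ)
_≟²_ = Product.≡-dec _≟_ _≟_

mark : ℕ × ℕ → ℕ → ℕ → ℕ → ℕ → List ℕ
mark c i s t x with (s , t) ≟² c
... | yes _ = x + s ∷ i + s ∷ []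
... | no  _ = x + s ∷ []

mark-here : ∀ s t i x → mark (s , t) i s t x ≡ x + s ∷ i + s ∷ []
mark-here s t i x with (s , t) ≟² (s , t)
... | yes _ = refl
... | no s≢ = ⊥-elim (s≢ refl)

least-mark : ∀ c i s t x → least (mark c i s t x) ≡ x + s
least-mark c i s t x with (s , t) ≟² c
... | yes _ = refl
... | no  _ = refl

fromTriple : Triple → Tableau
fromTriple (P , i , c) = mapGrid (mark c i) P

linked-at : {l : List ℕ} → Linked _≥_ l → (n : ℕ) {m : ℕ} → at l (suc (suc n)) ≡ just m →
  ∃ λ m′ → at l (suc n) ≡ just m′ × m ≤ m′
linked-at (x≥y ∷ _)              zero    refl = _ , refl , x≥y
linked-at (_ ∷ linked@(_ ∷ _))   (suc n) e    = linked-at linked n e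
linked-at (_ ∷ [-])              (suc n) ()

at-map⁻ : (f : A → B) (xs : List A) (t : ℕ) → at (map f xs) t ≡ just b →
  ∃ λ a → at xs t ≡ just a × f a ≡ b
at-map⁻ f xs t e with at xs t | at-map f xs t
... | just a  | eq = a , refl , just-injective (trans (sym eq) e)
... | nothing | eq with () ← trans (sym eq) e

square-above : (T : List (List A)) → Linked _≥_ (map length T) → (n t : ℕ) →
  entry T (suc (suc n)) t ≡ just a → ∃ λ a′ → entry T (suc n) t ≡ just a′
square-above T linked n t e
  with row , eT , e′ ← entry⇒at T (suc (suc n)) t e
  with m′ , eLen , row≤m′ ← linked-at linked n (trans (at-map length T (suc (suc n))) (cong (Maybe.map length) eT))
  with row′ , eT′ , refl ← at-map⁻ length T (suc n) eLen
  with 1≤t , t≤row ← at-bounds row t e′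
  with a′ , e″ ← at-inBounds row′ t 1≤t (≤-trans t≤row row≤m′)
  = a′ , at⇒entry T (suc n) t eT′ e″

module FromTableau {λ′ : List ℕ} {k : ℕ} {T : Tableau} (tab : IsBSSYT λ′ k T)
                   (linked : Linked _≥_ (map length T)) where
  open IsBSSYT tab

  nonempty : ∀ s t A → entry T s t ≡ just A → A ≢ []
  nonempty s t A e = proj₁ (sets s t A e)

  row≤entries : ∀ s t A → entry T s t ≡ just A → All (s ≤_) A
  row≤entries zero          t A e with () ← trans (sym (entry-row-0 T t)) e
  row≤entries (suc zero)    t A e = positive 1 t A e
  row≤entries (suc (suc n)) t A e =
    All.map (≤-trans (s≤s (least-All C (nonempty _ t C eC) (row≤entries (suc n) t C eC))))
            (least-All C (nonempty _ t C eC) (colStrict (suc n) t C A eC e))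
    where C  = proj₁ (square-above T linked n t e)
          eC = proj₂ (square-above T linked n t e)

  P : List (List ℕ)
  P = toRPP T

  P-entry : ∀ s t {x} → entry P s t ≡ just x → ∃ λ A → entry T s t ≡ just A × least A ∸ s ≡ x
  P-entry s t = entry-mapGrid⁻ _ T s t

  P-bounded : ∀ s t x → entry P s t ≡ just x → x ≤ k
  P-bounded s t x e with A , eA , refl ← P-entry s t e =
    m≤n+o⇒m∸o≤n (least A) k s (least-All A (nonempty s t A eA) (flagged s t A eA))

  P-rowWeak : ∀ s t x y → entry P s t ≡ just x → entry P s (suc t) ≡ just y → x ≤ y
  P-rowWeak s t x y ex ey
    with A , eA , refl ← P-entry s t ex
    with C , eC , refl ← P-entry s (suc t) ey =
    ∸-monoˡ-≤ s (least-All² A C (nonempty _ _ A eA) (nonempty _ _ C eC) (rowWeak s t A C eA eC))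

  P-colWeak : ∀ s t x y → entry P s t ≡ just x → entry P (suc s) t ≡ just y → x ≤ y
  P-colWeak s t x y ex ey
    with A , eA , refl ← P-entry s t ex
    with C , eC , refl ← P-entry (suc s) t ey =
    ∸-monoˡ-≤ (suc s) (least-All² A C (nonempty _ _ A eA) (nonempty _ _ C eC) (colStrict s t A C eA eC))

  toRPP-isRPP : IsRPP λ′ k P
  toRPP-isRPP = record
    { shape   = trans (shape-mapGrid _ T) shape
    ; bounded = P-bounded
    ; rowWeak = P-rowWeak
    ; colWeak = P-colWeak
    }

  module Doubled (s₀ t₀ a b : ℕ) (e₀ : entry T s₀ t₀ ≡ just (a ∷ b ∷ []))
                 (single : ∀ s t A → entry T s t ≡ just A → (s , t) ≢ (s₀ , t₀) → length A ≡ 1) where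

    toTriple-≡ : toTriple T ≡ (P , b ∸ s₀ , (s₀ , t₀))
    toTriple-≡ rewrite doubledSquare-unique T s₀ t₀ e₀ single = refl

    s₀≤a : s₀ ≤ a
    s₀≤a with s₀≤a ∷ _ ← row≤entries s₀ t₀ _ e₀ = s₀≤a

    s₀≤b : s₀ ≤ b
    s₀≤b with _ ∷ s₀≤b ∷ _ ← row≤entries s₀ t₀ _ e₀ = s₀≤b

    a<b : a < b
    a<b with _ , ((a<b ∷ []) ∷ _) ← sets s₀ t₀ _ e₀ = a<b

    b∸s₀≤k : b ∸ s₀ ≤ k
    b∸s₀≤k with _ ∷ b≤k+s₀ ∷ _ ← flagged s₀ t₀ _ e₀ = m≤n+o⇒m∸o≤n b k s₀ b≤k+s₀

    P-entry₀ : entry P s₀ t₀ ≡ just (a ∸ s₀)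
    P-entry₀ = trans (entry-mapGrid _ T s₀ t₀) (cong (Maybe.map _) e₀)

    not-below : ¬ InAlpha P (b ∸ s₀) (suc s₀) t₀
    not-below (y , ey , y<i)
      with C , eC , refl ← P-entry (suc s₀) t₀ ey
      with _ ∷ b<C ∷ [] ← colStrict s₀ t₀ _ C e₀ eC =
      <⇒≱ y<i (∸-monoˡ-≤ (suc s₀) (least-All C (nonempty _ _ C eC) b<C))

    not-right : ¬ InAlpha P (b ∸ s₀) s₀ (suc t₀)
    not-right (y , ey , y<i)
      with C , eC , refl ← P-entry s₀ (suc t₀) ey
      with _ ∷ b≤C ∷ [] ← rowWeak s₀ t₀ _ C e₀ eC =
      <⇒≱ y<i (∸-monoˡ-≤ s₀ (least-All C (nonempty _ _ C eC) b≤C))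

    isTriple : IsTriple λ′ k (toTriple T)
    isTriple rewrite toTriple-≡ =
      toRPP-isRPP , m<n⇒0<n∸m (≤-<-trans s₀≤a a<b) , b∸s₀≤k ,
      (a ∸ s₀ , P-entry₀ , ∸-monoˡ-< a<b s₀≤a) , not-below , not-right

    fromTriple-toTriple : fromTriple (toTriple T) ≡ T
    fromTriple-toTriple rewrite toTriple-≡ = mapGrid-cancel (mark (s₀ , t₀) (b ∸ s₀)) _ T restore
      where
        restore : ∀ s t A → entry T s t ≡ just A → mark (s₀ , t₀) (b ∸ s₀) s t (least A ∸ s) ≡ A
        restore s t A e with (s , t) ≟² (s₀ , t₀)
        ... | yes refl rewrite just-injective (trans (sym e) e₀) =
          cong₂ (λ a′ b′ → a′ ∷ b′ ∷ []) (m∸n+n≡m s₀≤a) (m∸n+n≡m s₀≤b)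
        ... | no st≢ with A | single s t A e st≢ | row≤entries s t A e
        ... | x ∷ [] | _ | s≤x ∷ [] = cong (_∷ []) (m∸n+n≡m s≤x)

module FromTriple {λ′ : List ℕ} {k : ℕ} {P : List (List ℕ)} {i s t : ℕ}
                  (rpp : IsRPP λ′ k P) (i≤k : i ≤ k)
                  {x₀ : ℕ} (e₀ : entry P s t ≡ just x₀) (x₀<i : x₀ < i)
                  (not-below : ¬ InAlpha P i (suc s) t) (not-right : ¬ InAlpha P i s (suc t)) where
  open IsRPP rpp

  T : Tableau
  T = fromTriple (P , i , (s , t))

  T-entry : ∀ s′ t′ {A} → entry T s′ t′ ≡ just A →
    ∃ λ x → entry P s′ t′ ≡ just x × mark (s , t) i s′ t′ x ≡ A
  T-entry s′ t′ = entry-mapGrid⁻ _ P s′ t′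

  T-entry₀ : entry T s t ≡ just (x₀ + s ∷ i + s ∷ [])
  T-entry₀ rewrite entry-mapGrid (mark (s , t) i) P s t | e₀ = cong just (mark-here s t i x₀)

  x≡x₀ : ∀ {x} → entry P s t ≡ just x → x ≡ x₀
  x≡x₀ e = just-injective (trans (sym e) e₀)

  i≤outside : ∀ {s′ t′ y} → ¬ InAlpha P i s′ t′ → entry P s′ t′ ≡ just y → i ≤ y
  i≤outside outside ey = ≮⇒≥ (λ y<i → outside (_ , ey , y<i))

  T-sets : ∀ s′ t′ A → entry T s′ t′ ≡ just A → IsFinSet A
  T-sets s′ t′ A e with x , ex , refl ← T-entry s′ t′ e with (s′ , t′) ≟² (s , t)
  ... | yes refl rewrite x≡x₀ ex = (λ ()) , ((+-monoˡ-< s x₀<i ∷ []) ∷ [] ∷ [])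
  ... | no  _    = (λ ()) , ([] ∷ [])

  T-positive : ∀ s′ t′ A → entry T s′ t′ ≡ just A → All (1 ≤_) A
  T-positive s′ t′ A e with x , ex , refl ← T-entry s′ t′ e with (s′ , t′) ≟² (s , t)
  ... | yes refl = ≤-trans 1≤s (m≤n+m s x) ∷ ≤-trans 1≤s (m≤n+m s i) ∷ []
    where 1≤s = entry⇒1≤row P s t ex
  ... | no  _    = ≤-trans (entry⇒1≤row P s′ t′ ex) (m≤n+m s′ x) ∷ []

  T-flagged : ∀ s′ t′ A → entry T s′ t′ ≡ just A → All (_≤ k + s′) A
  T-flagged s′ t′ A e with x , ex , refl ← T-entry s′ t′ e with (s′ , t′) ≟² (s , t)
  ... | yes refl = +-monoˡ-≤ s (bounded s t x ex) ∷ +-monoˡ-≤ s i≤k ∷ []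
  ... | no  _    = +-monoˡ-≤ s′ (bounded s′ t′ x ex) ∷ []

  T-single : ∀ s′ t′ A → entry T s′ t′ ≡ just A → (s′ , t′) ≢ (s , t) → length A ≡ 1
  T-single s′ t′ A e st≢ with x , ex , refl ← T-entry s′ t′ e with (s′ , t′) ≟² (s , t)
  ... | yes st≡ = ⊥-elim (st≢ st≡)
  ... | no  _   = refl

  T-rowWeak : ∀ s′ t′ A B → entry T s′ t′ ≡ just A → entry T s′ (suc t′) ≡ just B → MaxLeMin A B
  T-rowWeak s′ t′ A B eA eB
    with x , ex , refl ← T-entry s′ t′ eA
    with y , ey , refl ← T-entry s′ (suc t′) eB
    with x≤y ← rowWeak s′ t′ x y ex ey
    with (s′ , t′) ≟² (s , t) | (s′ , suc t′) ≟² (s , t)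
  ... | yes refl | yes st≡ = ⊥-elim (1+n≢n (cong proj₂ st≡))
  ... | yes refl | no  _   =
    (+-monoˡ-≤ s x≤y ∷ []) ∷ (+-monoˡ-≤ s (i≤outside not-right ey) ∷ []) ∷ []
  ... | no  _    | yes refl rewrite x≡x₀ ey =
    (+-monoˡ-≤ s x≤y ∷ +-monoˡ-≤ s (≤-trans x≤y (<⇒≤ x₀<i)) ∷ []) ∷ []
  ... | no  _    | no  _   = (+-monoˡ-≤ s′ x≤y ∷ []) ∷ []

  T-colStrict : ∀ s′ t′ A B → entry T s′ t′ ≡ just A → entry T (suc s′) t′ ≡ just B → MaxLtMin A B
  T-colStrict s′ t′ A B eA eB
    with x , ex , refl ← T-entry s′ t′ eA
    with y , ey , refl ← T-entry (suc s′) t′ eB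
    with x≤y ← colWeak s′ t′ x y ex ey
    with (s′ , t′) ≟² (s , t) | (suc s′ , t′) ≟² (s , t)
  ... | yes refl | yes st≡ = ⊥-elim (1+n≢n (cong proj₁ st≡))
  ... | yes refl | no  _   =
    (+-mono-≤-< x≤y (n<1+n s) ∷ []) ∷ (+-mono-≤-< (i≤outside not-below ey) (n<1+n s) ∷ []) ∷ []
  ... | no  _    | yes refl rewrite x≡x₀ ey =
    (+-mono-≤-< x≤y (n<1+n s′) ∷ +-mono-≤-< (≤-trans x≤y (<⇒≤ x₀<i)) (n<1+n s′) ∷ []) ∷ []
  ... | no  _    | no  _   = (+-mono-≤-< x≤y (n<1+n s′) ∷ []) ∷ []

  fromTriple-isBSSYT : IsBSSYT λ′ k T
  fromTriple-isBSSYT = record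
    { shape     = trans (shape-mapGrid _ P) shape
    ; sets      = T-sets
    ; positive  = T-positive
    ; rowWeak   = T-rowWeak
    ; colStrict = T-colStrict
    ; flagged   = T-flagged
    ; barely    = s , t , _ , T-entry₀ , refl , T-single
    }

  toTriple-fromTriple : toTriple T ≡ (P , i , (s , t))
  toTriple-fromTriple rewrite doubledSquare-unique T s t T-entry₀ T-single =
    cong₂ (λ Q j → Q , j , (s , t))
      (mapGrid-cancel _ (mark (s , t) i) P (λ s′ t′ x _ → trans (cong (_∸ s′) (least-mark (s , t) i s′ t′ x)) (m+n∸n≡m x s′)))
      (m+n∸n≡m i s)

module _ {λ′ : List ℕ} {k : ℕ} {T : Tableau} (partition : IsPartition λ′) (tab : IsBSSYT λ′ k T) where
  private
    linked : Linked _≥_ (map length T)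
    linked = subst (Linked _≥_) (sym (IsBSSYT.shape tab)) (proj₂ partition)

  toTriple-isTriple : IsTriple λ′ k (toTriple T)
  toTriple-isTriple with IsBSSYT.barely tab
  ... | s₀ , t₀ , a ∷ b ∷ [] , e₀ , refl , single =
    FromTableau.Doubled.isTriple tab linked s₀ t₀ a b e₀ single

  fromTriple-toTriple : fromTriple (toTriple T) ≡ T
  fromTriple-toTriple with IsBSSYT.barely tab
  ... | s₀ , t₀ , a ∷ b ∷ [] , e₀ , refl , single =
    FromTableau.Doubled.fromTriple-toTriple tab linked s₀ t₀ a b e₀ single

module _ {λ′ : List ℕ} {k : ℕ} where
  fromTriple-isBSSYT : {v : Triple} → IsTriple λ′ k v → IsBSSYT λ′ k (fromTriple v)
  fromTriple-isBSSYT (rpp , _ , i≤k , (_ , e₀ , x₀<i) , not-below , not-right) =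
    FromTriple.fromTriple-isBSSYT rpp i≤k e₀ x₀<i not-below not-right

  toTriple-fromTriple : {v : Triple} → IsTriple λ′ k v → toTriple (fromTriple v) ≡ v
  toTriple-fromTriple (rpp , _ , i≤k , (_ , e₀ , x₀<i) , not-below , not-right) =
    FromTriple.toTriple-fromTriple rpp i≤k e₀ x₀<i not-below not-right

_≟ᵀ_ : DecidableEquality Tableau
_≟ᵀ_ = List.≡-dec (List.≡-dec (List.≡-dec _≟_))

_≟ᵗ_ : DecidableEquality Triple
_≟ᵗ_ = Product.≡-dec (List.≡-dec (List.≡-dec _≟_)) (Product.≡-dec _≟_ _≟²_)

theorem3p2 : (λ′ : List ℕ) → IsPartition λ′ → (k : ℕ) → 1 ≤ k → BSSYT λ′ k ⤖ Triples λ′ k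
theorem3p2 λ′ partition k _ =
  refinement-⤖ _≟ᵀ_ _≟ᵗ_ toTriple fromTriple
    (toTriple-isTriple partition) fromTriple-isBSSYT
    toTriple-fromTriple (fromTriple-toTriple partition)
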